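{- Let $s\geq 2$ and $n\geq 2$ be integers and let $c=M_s(n)$. If $n<cs-\bigl(1+\sqrt{4s(c+1)-3}\bigr)/2$, then $M_s(n+1)\leq M_s(n)+1$.
   Context: For integers $c,s\geq 1$, $K_{c\times s}$ denotes the complete multipartite graph with $c$ classes of $s$ vertices each. For a subgraph $H$ of $K_{c\times s}$, $\overline{H}$ denotes the complement of $H$ relative to $K_{c\times s}$. $C_4$ is the $4$-cycle and $K_{1,n}$ is the star with $n+1$ vertices. $M_s(n)$ is the smallest positive integer $c$ such that for every subgraph $H$ of $K_{c\times s}$, $H$ contains a copy of $C_4$ or $\overline{H}$ contains a copy of $K_{1,n}$. -}

module Defs where

open import Data.Nat using (ℕ; zero; suc; _+_; _*_; _∸_; _^_; _≤_; _<_)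
open import Data.Fin using (Fin)
open import Data.Bool using (Bool; true)
open import Data.Product using (_×_; Σ; ∃; ∃-syntax; _,_; proj₁)
open import Data.Sum using (_⊎_)
open import Relation.Nullary using (¬_)
open import Relation.Binary.PropositionalEquality using (_≡_; _≢_)
open import Function.Definitions using (Injective)

-- Vertices of K_{c×s}: (class , index within class)
Vtx : ℕ → ℕ → Set
Vtx c s = Fin c × Fin s

KAdj : ∀ {c s} → Vtx c s → Vtx c s → Set
KAdj u v = proj₁ u ≢ proj₁ v

-- A subgraph H of K_{c×s}: a symmetric Boolean relation E; the edges of H are
-- the pairs uv with KAdj u v and E u v ≡ true.
record Subgraph (c s : ℕ) : Set where
  field
    E   : Vtx c s → Vtx c s → Bool
    sym : ∀ u v → E u v ≡ E v u

open Subgraph public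

HAdj : ∀ {c s} → Subgraph c s → Vtx c s → Vtx c s → Set
HAdj H u v = KAdj u v × E H u v ≡ true

CAdj : ∀ {c s} → Subgraph c s → Vtx c s → Vtx c s → Set
CAdj H u v = KAdj u v × ¬ (E H u v ≡ true)

HasC4 : ∀ {c s} → Subgraph c s → Set
HasC4 {c} {s} H =
  Σ (Vtx c s) λ v0 → Σ (Vtx c s) λ v1 → Σ (Vtx c s) λ v2 → Σ (Vtx c s) λ v3 →
    (v0 ≢ v1 × v0 ≢ v2 × v0 ≢ v3 × v1 ≢ v2 × v1 ≢ v3 × v2 ≢ v3) ×
    (HAdj H v0 v1 × HAdj H v1 v2 × HAdj H v2 v3 × HAdj H v3 v0)

ComplHasStar : ∀ {c s} → Subgraph c s → ℕ → Set
ComplHasStar {c} {s} H n =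
  Σ (Vtx c s) λ centre → Σ (Fin n → Vtx c s) λ leaf →
    Injective _≡_ _≡_ leaf × (∀ i → (leaf i ≢ centre) × CAdj H centre (leaf i))

Arrows : ℕ → ℕ → ℕ → Set
Arrows s n c = (H : Subgraph c s) → HasC4 H ⊎ ComplHasStar H n

IsM : ℕ → ℕ → ℕ → Set
IsM s n c = 1 ≤ c × Arrows s n c × (∀ c′ → 1 ≤ c′ → c′ < c → ¬ Arrows s n c′)

-- M_s(n) ≤ b  (the least element of {c ≥ 1 : Arrows s n c} is ≤ b)
MLe : ℕ → ℕ → ℕ → Set
MLe s n b = ∃[ c′ ] (1 ≤ c′ × c′ ≤ b × Arrows s n c′)

-- n < c s − (1 + √(4 s (c+1) − 3)) / 2, cleared of the square root:
-- equivalent to  2n+1 < 2cs  and  4s(c+1) − 3 < (2cs − 2n − 1)^2.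
SqrtCond : ℕ → ℕ → ℕ → Set
SqrtCond s n c =
  (2 * n + 1 < 2 * c * s) × (4 * s * (c + 1) < (2 * c * s ∸ (2 * n + 1)) ^ 2 + 3)

-- Every vertex of K_{(c+1)×s} has cs neighbours there; if the complement of H has no K_{1,n+1},
-- at most n of them are missing from H, so every H-degree is at least δ = cs − n.  If H also has
-- no C_4, distinct neighbours of a vertex v share no neighbour besides v, so v, its neighbours and
-- their further neighbours are 1 + δ(δ − 1) distinct vertices (a Moore-type bound).  The
-- square-root hypothesis says exactly that (c+1)s ≤ δ(δ − 1), a contradiction.
module Submission where

open import Data.Bool using (true)
import Data.Bool as Bool
open import Data.Empty using (⊥-elim)
open import Data.Fin using (Fin; zero; suc; inject≤; combine; remQuot; fromℕ<)
import Data.Fin as Fin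
import Data.Fin.Properties as Finₚ
open import Data.List using (List; []; _∷_; length; filter; map; concat; lookup; allFin)
open import Data.List.Properties using (length-++; length-map; length-tabulate; filter-all)
open import Data.List.Membership.Propositional using (_∈_; lose; find)
open import Data.List.Membership.Propositional.Properties
  using (∈-lookup; ∈-concat⁻′; ∈-map⁻; ∈-filter⁻)
import Data.List.Membership.DecPropositional as DecMembership
import Data.List.Relation.Unary.All as All
open import Data.List.Relation.Unary.Any using (here; there; any?)
open import Data.List.Relation.Unary.Unique.Propositional using (Unique; []; _∷_)
import Data.List.Relation.Unary.Unique.Propositional.Properties as Uniqueₚ
open import Data.Nat using (ℕ; suc; _+_; _*_; _∸_; _^_; _≤_; _<_; z≤n; s≤s; s≤s⁻¹; _≤?_)
open import Data.Nat.Properties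
open import Data.Nat.Tactic.RingSolver using (solve-∀)
open import Data.Product using (_×_; ∃-syntax; _,_; proj₁; proj₂; uncurry)
open import Data.Product.Properties using (≡-dec)
open import Data.Sum using (_⊎_; inj₁; inj₂; fromInj₁)
open import Function using (_∘_; id)
open import Level using (Level)
open import Relation.Binary.Definitions using (DecidableEquality)
open import Relation.Binary.PropositionalEquality
  using (_≡_; _≢_; refl; sym; trans; cong; cong₂; subst; subst₂; module ≡-Reasoning)
open import Relation.Nullary using (yes; no; ¬?)
open import Relation.Nullary.Decidable using (_×-dec_)
open import Relation.Unary using (Pred; Decidable)

open import Defs hiding (sym)

private variable
  a b : Level
  A : Set a
  B : Set b

lookup-injective : (xs : List A) → Unique xs → ∀ {i j} → lookup xs i ≡ lookup xs j → i ≡ j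
lookup-injective (x ∷ xs) (x∉xs ∷ u) {zero}  {zero}  eq = refl
lookup-injective (x ∷ xs) (x∉xs ∷ u) {zero}  {suc j} eq = ⊥-elim (All.lookup x∉xs (∈-lookup j) eq)
lookup-injective (x ∷ xs) (x∉xs ∷ u) {suc i} {zero}  eq = ⊥-elim (All.lookup x∉xs (∈-lookup i) (sym eq))
lookup-injective (x ∷ xs) (x∉xs ∷ u) {suc i} {suc j} eq = cong suc (lookup-injective xs u eq)

Unique⇒length≤ : ∀ {N} (g : A → Fin N) {xs : List A} → Unique xs →
  (∀ {x y} → x ∈ xs → y ∈ xs → g x ≡ g y → x ≡ y) → length xs ≤ N
Unique⇒length≤ g {xs} u g-inj = Finₚ.injective⇒≤ {f = g ∘ lookup xs}
  (lookup-injective xs u ∘ g-inj (∈-lookup _) (∈-lookup _))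

length-filter+length-filter-¬ : ∀ {p} {P : Pred A p} (P? : Decidable P) xs →
  length (filter P? xs) + length (filter (¬? ∘ P?) xs) ≡ length xs
length-filter+length-filter-¬ P? []       = refl
length-filter+length-filter-¬ P? (x ∷ xs) with P? x
... | yes _ = cong suc (length-filter+length-filter-¬ P? xs)
... | no  _ = trans (+-suc _ _) (cong suc (length-filter+length-filter-¬ P? xs))

length≤1+length-filter-≢ : (_≟_ : DecidableEquality A) (v : A) {xs : List A} → Unique xs →
  length xs ≤ suc (length (filter (λ w → ¬? (v ≟ w)) xs))
length≤1+length-filter-≢ _≟_ v {[]}     []           = z≤n
length≤1+length-filter-≢ _≟_ v {x ∷ xs} (x∉xs ∷ u) with v ≟ x
... | yes refl = s≤s (≤-reflexive (sym (cong length (filter-all (λ w → ¬? (v ≟ w)) x∉xs))))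
... | no  _    = s≤s (length≤1+length-filter-≢ _≟_ v u)

Unique-concat-map : (f : A → List B) {xs : List A} → Unique xs →
  (∀ {x} → x ∈ xs → Unique (f x)) →
  (∀ {x y w} → x ∈ xs → y ∈ xs → w ∈ f x → w ∈ f y → x ≡ y) →
  Unique (concat (map f xs))
Unique-concat-map f []           _      _        = []
Unique-concat-map f (x∉xs ∷ u) unique disjoint =
  Uniqueₚ.++⁺ (unique (here refl))
    (Unique-concat-map f u (unique ∘ there) (λ x∈ y∈ → disjoint (there x∈) (there y∈)))
    λ (w∈fx , w∈rest) →
      let ys , w∈ys , ys∈ = ∈-concat⁻′ _ w∈rest
          y , y∈xs , ys≡fy = ∈-map⁻ f ys∈
      in All.lookup x∉xs y∈xs (disjoint (here refl) (there y∈xs) w∈fx (subst (_ ∈_) ys≡fy w∈ys))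

length*≤length-concat-map : (f : A → List B) (m : ℕ) (xs : List A) →
  (∀ {x} → x ∈ xs → m ≤ length (f x)) → length xs * m ≤ length (concat (map f xs))
length*≤length-concat-map f m []       _     = z≤n
length*≤length-concat-map f m (x ∷ xs) large =
  subst (m + length xs * m ≤_) (sym (length-++ (f x)))
    (+-mono-≤ (large (here refl)) (length*≤length-concat-map f m xs (large ∘ there)))

private
  double-suc : ∀ n → 2 * suc n ≡ suc (2 * n + 1)
  double-suc = solve-∀
  double-split : ∀ n e → 2 * (suc n + e) ≡ (2 * n + 1) + (1 + 2 * e)
  double-split = solve-∀
  -- the left-hand side is what (1 + 2 * e) ^ 2 + 3 unfolds to
  odd-square : ∀ e → (1 + 2 * e) * ((1 + 2 * e) * 1) + 3 ≡ 4 * (1 + (1 + e) * e)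
  odd-square = solve-∀
  four-mul : ∀ c s → 4 * s * (c + 1) ≡ 4 * ((c + 1) * s)
  four-mul = solve-∀

-- e + 1 = cs − n is the H-degree forced on every vertex.
SqrtCond⇒mooreBound : ∀ s n c → SqrtCond s n c →
  ∃[ e ] (c * s ≡ suc n + e × (c + 1) * s ≤ suc e * e)
SqrtCond⇒mooreBound s n c (2n+1<2cs , squareBound) = e , cs≡ , s≤s⁻¹ (*-cancelˡ-< 4 _ _ bound)
  where
  n<cs : suc n ≤ c * s
  n<cs = *-cancelˡ-≤ 2 (begin
    2 * suc n         ≡⟨ double-suc n ⟩
    suc (2 * n + 1)   ≤⟨ 2n+1<2cs ⟩
    2 * c * s         ≡⟨ *-assoc 2 c s ⟩
    2 * (c * s)       ∎)
    where open ≤-Reasoning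
  e = c * s ∸ suc n
  cs≡ : c * s ≡ suc n + e
  cs≡ = sym (m+[n∸m]≡n n<cs)
  gap : 2 * c * s ∸ (2 * n + 1) ≡ 1 + 2 * e
  gap = begin
    2 * c * s ∸ (2 * n + 1)                 ≡⟨ cong (_∸ (2 * n + 1)) (*-assoc 2 c s) ⟩
    2 * (c * s) ∸ (2 * n + 1)               ≡⟨ cong (λ t → 2 * t ∸ (2 * n + 1)) cs≡ ⟩
    2 * (suc n + e) ∸ (2 * n + 1)           ≡⟨ cong (_∸ (2 * n + 1)) (double-split n e) ⟩
    (2 * n + 1) + (1 + 2 * e) ∸ (2 * n + 1) ≡⟨ m+n∸m≡n (2 * n + 1) (1 + 2 * e) ⟩
    1 + 2 * e                               ∎
    where open ≡-Reasoning
  bound : 4 * ((c + 1) * s) < 4 * suc (suc e * e)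
  bound = subst₂ _<_ (four-mul c s) (trans (cong (λ t → t ^ 2 + 3) gap) (odd-square e)) squareBound

_≟ᵥ_ : ∀ {C s} → DecidableEquality (Vtx C s)
_≟ᵥ_ = ≡-dec Fin._≟_ Fin._≟_

vertices : ∀ {C s} → List (Vtx C s)
vertices {C} {s} = map (remQuot {C} s) (allFin (C * s))

length-vertices : ∀ {C s} → length (vertices {C} {s}) ≡ C * s
length-vertices {C} {s} = trans (length-map (remQuot {C} s) (allFin (C * s))) (length-tabulate id)

vertices-unique : ∀ {C s} → Unique (vertices {C} {s})
vertices-unique {C} {s} = Uniqueₚ.map⁺ remQuot-injective (Uniqueₚ.allFin⁺ (C * s))
  where
  remQuot-injective : ∀ {i j} → remQuot {C} s i ≡ remQuot s j → i ≡ j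
  remQuot-injective {i} {j} eq = begin
    i                                 ≡⟨ Finₚ.combine-remQuot {C} s i ⟨
    uncurry combine (remQuot {C} s i) ≡⟨ cong (uncurry combine) eq ⟩
    uncurry combine (remQuot {C} s j) ≡⟨ Finₚ.combine-remQuot {C} s j ⟩
    j                                 ∎
    where open ≡-Reasoning

Unique⇒length≤vertexCount : ∀ {C s} {xs : List (Vtx C s)} → Unique xs → length xs ≤ C * s
Unique⇒length≤vertexCount {C} {s} u = Unique⇒length≤ (uncurry combine) u λ {x} {y} _ _ eq → begin
  x                                ≡⟨ Finₚ.remQuot-combine (proj₁ x) (proj₂ x) ⟨
  remQuot s (uncurry combine x)    ≡⟨ cong (remQuot s) eq ⟩
  remQuot s (uncurry combine y)    ≡⟨ Finₚ.remQuot-combine (proj₁ y) (proj₂ y) ⟩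
  y                                ∎
  where open ≡-Reasoning

module _ {C s : ℕ} (H : Subgraph C s) where

  sameClass otherClass neighbours nonNeighbours : Vtx C s → List (Vtx C s)
  sameClass u = filter (λ w → proj₁ u Fin.≟ proj₁ w) vertices
  otherClass u = filter (λ w → ¬? (proj₁ u Fin.≟ proj₁ w)) vertices
  neighbours u = filter (λ w → E H u w Bool.≟ true) (otherClass u)
  nonNeighbours u = filter (λ w → ¬? (E H u w Bool.≟ true)) (otherClass u)

  neighbours-unique : ∀ u → Unique (neighbours u)
  neighbours-unique u = Uniqueₚ.filter⁺ _ (Uniqueₚ.filter⁺ _ vertices-unique)

  nonNeighbours-unique : ∀ u → Unique (nonNeighbours u)
  nonNeighbours-unique u = Uniqueₚ.filter⁺ _ (Uniqueₚ.filter⁺ _ vertices-unique)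

  ∈-neighbours⁻ : ∀ {u w} → w ∈ neighbours u → HAdj H u w
  ∈-neighbours⁻ {u} w∈ =
    let w∈other , edge = ∈-filter⁻ (λ w → E H u w Bool.≟ true) {xs = otherClass u} w∈
    in proj₂ (∈-filter⁻ (λ w → ¬? (proj₁ u Fin.≟ proj₁ w)) {xs = vertices} w∈other) , edge

  ∈-nonNeighbours⁻ : ∀ {u w} → w ∈ nonNeighbours u → CAdj H u w
  ∈-nonNeighbours⁻ {u} w∈ =
    let w∈other , ¬edge = ∈-filter⁻ (λ w → ¬? (E H u w Bool.≟ true)) {xs = otherClass u} w∈
    in proj₂ (∈-filter⁻ (λ w → ¬? (proj₁ u Fin.≟ proj₁ w)) {xs = vertices} w∈other) , ¬edge

  HAdj⇒≢ : ∀ {u w} → HAdj H u w → u ≢ w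
  HAdj⇒≢ (classes≢ , _) u≡w = classes≢ (cong proj₁ u≡w)

  HAdj-sym : ∀ {u w} → HAdj H u w → HAdj H w u
  HAdj-sym {u} {w} (classes≢ , edge) = classes≢ ∘ sym , trans (Subgraph.sym H w u) edge

  length-sameClass≤ : ∀ u → length (sameClass u) ≤ s
  length-sameClass≤ u = Unique⇒length≤ proj₂ (Uniqueₚ.filter⁺ _ vertices-unique) λ x∈ y∈ →
    cong₂ _,_ (trans (sym (classOf x∈)) (classOf y∈))
    where
    classOf : ∀ {w} → w ∈ sameClass u → proj₁ u ≡ proj₁ w
    classOf w∈ = proj₂ (∈-filter⁻ (λ w → proj₁ u Fin.≟ proj₁ w) {xs = vertices} w∈)

  vertexCount≤ : ∀ u → C * s ≤ s + (length (neighbours u) + length (nonNeighbours u))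
  vertexCount≤ u = begin
    C * s
      ≡⟨ length-vertices {C} {s} ⟨
    length (vertices {C} {s})
      ≡⟨ length-filter+length-filter-¬ (λ w → proj₁ u Fin.≟ proj₁ w) vertices ⟨
    length (sameClass u) + length (otherClass u)
      ≡⟨ cong (length (sameClass u) +_)
           (length-filter+length-filter-¬ (λ w → E H u w Bool.≟ true) (otherClass u)) ⟨
    length (sameClass u) + (length (neighbours u) + length (nonNeighbours u))
      ≤⟨ +-monoˡ-≤ _ (length-sameClass≤ u) ⟩
    s + (length (neighbours u) + length (nonNeighbours u))
      ∎
    where open ≤-Reasoning

  complementStar : ∀ u m → m ≤ length (nonNeighbours u) → ComplHasStar H m
  complementStar u m m≤ = u , leaf , leaf-injective , λ i → leaf-adjacent i
    where
    leaf : Fin m → Vtx C s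
    leaf i = lookup (nonNeighbours u) (inject≤ i m≤)
    leaf-injective : ∀ {i j} → leaf i ≡ leaf j → i ≡ j
    leaf-injective {i} {j} eq =
      Finₚ.inject≤-injective m≤ m≤ i j (lookup-injective _ (nonNeighbours-unique u) eq)
    leaf-adjacent : ∀ i → leaf i ≢ u × CAdj H u (leaf i)
    leaf-adjacent i = let adj = ∈-nonNeighbours⁻ (∈-lookup (inject≤ i m≤))
                      in (λ eq → proj₁ adj (cong proj₁ (sym eq))) , adj

  neighboursExcept : Vtx C s → Vtx C s → List (Vtx C s)
  neighboursExcept v a = filter (λ w → ¬? (v ≟ᵥ w)) (neighbours a)

  ∈-neighboursExcept⁻ : ∀ {v a w} → w ∈ neighboursExcept v a → HAdj H a w × v ≢ w
  ∈-neighboursExcept⁻ {v} {a} w∈ =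
    let w∈nb , v≢w = ∈-filter⁻ (λ w → ¬? (v ≟ᵥ w)) {xs = neighbours a} w∈
    in ∈-neighbours⁻ w∈nb , v≢w

  NoSharedNeighbour : Vtx C s → Set
  NoSharedNeighbour v = ∀ {a a′ w} → a ∈ neighbours v → a′ ∈ neighbours v →
    w ∈ neighboursExcept v a → w ∈ neighboursExcept v a′ → a ≡ a′

  4-cycle : ∀ {v a a′ w} → HAdj H v a → HAdj H v a′ → a ≢ a′ →
    HAdj H a w → HAdj H a′ w → v ≢ w → HasC4 H
  4-cycle va va′ a≢a′ aw a′w v≢w =
    _ , _ , _ , _ ,
    (HAdj⇒≢ va , v≢w , HAdj⇒≢ va′ , HAdj⇒≢ aw , a≢a′ , HAdj⇒≢ (HAdj-sym a′w)) ,
    (va , aw , HAdj-sym a′w , HAdj-sym va′)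

  open DecMembership (_≟ᵥ_ {C} {s}) using (_∈?_)

  C4⊎noSharedNeighbour : ∀ v → HasC4 H ⊎ NoSharedNeighbour v
  C4⊎noSharedNeighbour v with any? (λ a → any? (λ a′ → ¬? (a ≟ᵥ a′) ×-dec
                                any? (_∈? neighboursExcept v a′) (neighboursExcept v a))
                              (neighbours v)) (neighbours v)
  ... | yes shared =
    let a , a∈ , shared′ = find shared
        a′ , a′∈ , a≢a′ , common = find shared′
        w , w∈a , w∈a′ = find common
        aw , v≢w = ∈-neighboursExcept⁻ w∈a
        a′w , _ = ∈-neighboursExcept⁻ w∈a′
    in inj₁ (4-cycle (∈-neighbours⁻ a∈) (∈-neighbours⁻ a′∈) a≢a′ aw a′w v≢w)
  ... | no noneShared = inj₂ disjoint
    where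
    disjoint : NoSharedNeighbour v
    disjoint {a} {a′} a∈ a′∈ w∈a w∈a′ with a ≟ᵥ a′
    ... | yes a≡a′ = a≡a′
    ... | no  a≢a′ = ⊥-elim (noneShared (lose a∈ (lose a′∈ (a≢a′ , lose w∈a w∈a′))))

  -- v, its neighbours and their further neighbours are pairwise distinct vertices.
  mooreBound : ∀ v d → (∀ {a} → a ∈ neighbours v → suc d ≤ length (neighbours a)) →
    NoSharedNeighbour v → suc (length (neighbours v) * d) ≤ C * s
  mooreBound v d degree disjoint = begin
    suc (length (neighbours v) * d) ≤⟨ s≤s (length*≤length-concat-map (neighboursExcept v) d (neighbours v) degreeExcept) ⟩
    length (v ∷ ball)               ≤⟨ Unique⇒length≤vertexCount (All.tabulate v∉ball ∷ ball-unique) ⟩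
    C * s                           ∎
    where
    open ≤-Reasoning
    ball : List (Vtx C s)
    ball = concat (map (neighboursExcept v) (neighbours v))
    degreeExcept : ∀ {a} → a ∈ neighbours v → d ≤ length (neighboursExcept v a)
    degreeExcept {a} a∈ = s≤s⁻¹ (≤-trans (degree a∈)
      (length≤1+length-filter-≢ _≟ᵥ_ v (neighbours-unique a)))
    ball-unique : Unique ball
    ball-unique = Unique-concat-map (neighboursExcept v) (neighbours-unique v)
      (λ {a} _ → Uniqueₚ.filter⁺ _ (neighbours-unique a)) disjoint
    v∉ball : ∀ {w} → w ∈ ball → v ≢ w
    v∉ball w∈ =
      let ys , w∈ys , ys∈ = ∈-concat⁻′ (map (neighboursExcept v) (neighbours v)) w∈
          a , _ , ys≡ = ∈-map⁻ (neighboursExcept v) ys∈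
      in proj₂ (∈-neighboursExcept⁻ (subst (_ ∈_) ys≡ w∈ys))

  minDegree⇒C4 : Vtx C s → ∀ e → C * s ≤ suc e * e →
    (∀ u → suc e ≤ length (neighbours u)) → HasC4 H
  minDegree⇒C4 v e few degree = fromInj₁ noSharedNeighbour-impossible (C4⊎noSharedNeighbour v)
    where
    noSharedNeighbour-impossible : NoSharedNeighbour v → HasC4 H
    noSharedNeighbour-impossible disjoint = ⊥-elim (<⇒≱ (mooreBound v e (λ _ → degree _) disjoint)
      (≤-trans few (*-monoˡ-≤ e (degree v))))

nonNeighbours≤⇒neighbours≥ : ∀ {c s n e} (H : Subgraph (c + 1) s) → c * s ≡ suc n + e →
  ∀ u → length (nonNeighbours H u) ≤ n → suc e ≤ length (neighbours H u)
nonNeighbours≤⇒neighbours≥ {c} {s} {n} {e} H cs≡ u fewNon = +-cancelˡ-≤ (s + n) _ _ (begin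
  s + n + suc e                                              ≡⟨ +-assoc s n (suc e) ⟩
  s + (n + suc e)                                            ≡⟨ cong (s +_) (+-suc n e) ⟩
  s + (suc n + e)                                            ≡⟨ cong (s +_) cs≡ ⟨
  s + c * s                                                  ≡⟨ cong (_* s) (+-comm c 1) ⟨
  (c + 1) * s                                                ≤⟨ vertexCount≤ H u ⟩
  s + (length (neighbours H u) + length (nonNeighbours H u)) ≤⟨ +-monoʳ-≤ s (+-monoʳ-≤ _ fewNon) ⟩
  s + (length (neighbours H u) + n)                          ≡⟨ cong (s +_) (+-comm _ n) ⟩
  s + (n + length (neighbours H u))                          ≡⟨ +-assoc s n _ ⟨
  s + n + length (neighbours H u)                            ∎)
  where open ≤-Reasoning

arrows-suc : ∀ s n c → 1 ≤ s → SqrtCond s n c → Arrows s (n + 1) (c + 1)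
arrows-suc s n c 1≤s cond H
  with Finₚ.any? (λ i → Finₚ.any? (λ j → n + 1 ≤? length (nonNeighbours H (i , j))))
... | yes (i , j , manyNon) = inj₂ (complementStar H (i , j) (n + 1) manyNon)
... | no noneManyNon with SqrtCond⇒mooreBound s n c cond
...   | e , cs≡ , moore =
  inj₁ (minDegree⇒C4 H v e moore λ u → nonNeighbours≤⇒neighbours≥ H cs≡ u (fewNon u))
  where
  v : Vtx (c + 1) s
  v = fromℕ< (m≤n+m 1 c) , fromℕ< 1≤s
  fewNon : ∀ u → length (nonNeighbours H u) ≤ n
  fewNon (i , j) = s≤s⁻¹ (subst (suc (length (nonNeighbours H (i , j))) ≤_) (+-comm n 1)
    (≰⇒> (λ manyNon → noneManyNon (i , j , manyNon))))

proposition2p2 : ∀ (s n c : ℕ) → 2 ≤ s → 2 ≤ n → IsM s n c → SqrtCond s n c →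
    MLe s (n + 1) (c + 1)
proposition2p2 s n c 2≤s _ _ cond =
  c + 1 , m≤n+m 1 c , ≤-refl , arrows-suc s n c (≤-trans (s≤s z≤n) 2≤s) cond
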